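{- In any execution of Algorithm 1 (described in the context), at any point of time the following statements are equivalent: (1) the network is in quiescence; (2) $\rho_{cw}(v)\ge\mathrm{ID}(v)$ for every node $v$; (3) $\rho_{cw}(v)=\sigma_{cw}(v)=\mathrm{ID}_{\max}$ for every node $v$.
   Context: Oriented ring of $n$ nodes, content-oblivious asynchronous model (content-free pulses, arbitrary finite delays, no loss or injection; each node has an incoming queue per port). Each node $v$ has a unique positive integer ID $\mathrm{ID}(v)$; $\mathrm{ID}_{\max}=\max_v\mathrm{ID}(v)$. $\rho_{cw}(v)$ and $\sigma_{cw}(v)$ are the numbers of clockwise (CW) pulses node $v$ has received (consumed from its queue) and sent, initially 0. Algorithm 1 at node $v$: first send one CW pulse; then loop forever: if a CW pulse is waiting, consume it (incrementing $\rho_{cw}(v)$); then if $\rho_{cw}(v)=\mathrm{ID}(v)$ set state to Leader and send nothing, otherwise set state to Non-Leader and send one CW pulse. Quiescence: no pulses in transit (every sent pulse has been consumed); times are considered at ends of loop iterations. -}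

module Defs where

open import Data.Nat using (ℕ; zero; suc; _<_; _⊔_)
open import Data.Fin using (Fin; zero; suc; fromℕ; inject₁; _≟_)
open import Data.List using (List; foldr; map; allFin)
open import Data.Bool using (if_then_else_; _∧_; not)
open import Relation.Nullary.Decidable using (⌊_⌋)
import Data.Nat as ℕ
open import Relation.Binary.PropositionalEquality using (_≡_)

-- Clockwise (CW) pulses
-- travel from node i to node i+1 (mod n), so node v receives its CW pulses
-- from its counter-clockwise neighbour ccw v = v - 1 (mod n).
ccw : ∀ {m} → Fin (suc m) → Fin (suc m)
ccw {m} zero = fromℕ m
ccw (suc i)  = inject₁ i

IDmax : ∀ {n} → (Fin n → ℕ) → ℕ
IDmax {n} ID = foldr _⊔_ 0 (map ID (allFin n))

-- A global configuration (at the end of loop iterations):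
-- rcv v = ρ_cw(v)  (CW pulses consumed by v),
-- snd v = σ_cw(v)  (CW pulses sent by v).
-- Pulses are content-free and never lost or injected, so the number of
-- pulses in transit (in the channel or in the queue) towards v is
-- snd (ccw v) - rcv v.
record Config (n : ℕ) : Set where
  constructor ⟨_,_⟩
  field
    rcv : Fin n → ℕ
    snd : Fin n → ℕ
open Config public

module Algorithm1 {m : ℕ} (ID : Fin (suc m) → ℕ) where

  -- Initial configuration: every node has performed its initial CW send.
  initial : Config (suc m)
  initial = ⟨ (λ _ → 0) , (λ _ → 1) ⟩

  -- One loop iteration of node v in which a waiting CW pulse is consumed:
  -- ρ_cw(v) is incremented; if now ρ_cw(v) = ID(v) nothing is sent
  -- (Leader), otherwise one CW pulse is sent (Non-Leader).
  -- (Loop iterations with no waiting pulse change nothing.)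
  fire : Config (suc m) → Fin (suc m) → Config (suc m)
  fire c v =
    ⟨ (λ w → if ⌊ w ≟ v ⌋ then suc (rcv c v) else rcv c w)
    , (λ w → if ⌊ w ≟ v ⌋ ∧ not ⌊ suc (rcv c v) ℕ.≟ ID v ⌋
               then suc (snd c v) else snd c w) ⟩

  data Reachable : Config (suc m) → Set where
    init : Reachable initial
    step : ∀ {c} → Reachable c → (v : Fin (suc m)) →
           rcv c v < snd c (ccw v) → Reachable (fire c v)

  Quiescent : Config (suc m) → Set
  Quiescent c = ∀ v → snd c (ccw v) ≡ rcv c v

-- Each node's counters are in one of two local states: before its own ID is
-- reached it has sent exactly one pulse more than it received, afterwards it
-- has sent exactly as many as it received; moreover no node has received more
-- than its predecessor sent, and nobody ever sends more than ID_max pulses.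
-- In quiescence (resp. once every ρ(v) ≥ ID(v)) the inequalities
-- ρ(ccw v) ≤ σ(ccw v) = ρ(v) (resp. ρ(v) ≤ σ(ccw v) = ρ(ccw v)) go around the
-- ring, so all ρ(v) coincide; the local states then force σ = ρ and ID ≤ ρ,
-- and the bound σ ≤ ID_max pins the common value down to ID_max.
module Submission where

open import Defs
open import Data.Bool using (if_then_else_; not)
open import Data.Nat using (ℕ; zero; suc; _≥_; _>_; _≤_; _<_; z≤n; s≤s; _⊔_)
import Data.Nat as ℕ
open import Data.Nat.Properties
  using (≤-refl; ≤-trans; ≤-antisym; ≤-reflexive; <-irrefl; ≤∧≢⇒<; n≤1+n;
         m≤n⇒m≤1+n; 1+n≢n; ⊔-lub; m≤n⊔m; m≤n⇒m≤n⊔o; m≤n⇒m≤o⊔n)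
open import Data.Fin using (Fin; zero; suc; toℕ; fromℕ; inject₁; lower₁; _≟_)
open import Data.Fin.Properties using (toℕ-injective; toℕ-fromℕ; inject₁-lower₁)
open import Data.List using (foldr; map; allFin)
open import Data.List.Properties using (foldr-preservesᵇ; foldr-preservesᵒ)
open import Data.List.Relation.Unary.All using (universal)
import Data.List.Relation.Unary.All.Properties as All
import Data.List.Relation.Unary.Any as Any
open import Data.List.Membership.Propositional.Properties using (∈-map⁺; ∈-allFin)
open import Data.Product using (_×_; _,_; proj₁; proj₂; ∃)
open import Data.Sum using (inj₁; inj₂)
open import Data.Empty using (⊥-elim)
open import Relation.Nullary using (yes; no)
open import Relation.Nullary.Decidable using (⌊_⌋)
open import Relation.Binary.Core using (Rel)
open import Relation.Binary.Definitions using (Reflexive; Transitive)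
open import Function.Definitions using (Injective)
open import Relation.Binary.PropositionalEquality using (_≡_; refl; sym; trans; cong; subst)

IDmax-upperBound : ∀ {n} (ID : Fin n → ℕ) v → ID v ≤ IDmax ID
IDmax-upperBound {n} ID v =
  foldr-preservesᵒ {P = ID v ≤_}
    (λ { _ _ (inj₁ p) → m≤n⇒m≤n⊔o _ p ; _ _ (inj₂ p) → m≤n⇒m≤o⊔n _ p })
    0 (map ID (allFin n)) (inj₂ (Any.map ≤-reflexive (∈-map⁺ ID (∈-allFin v))))

IDmax-least : ∀ {n} (ID : Fin n → ℕ) {b} → (∀ v → ID v ≤ b) → IDmax ID ≤ b
IDmax-least {n} ID {b} bound =
  foldr-preservesᵇ {P = _≤ b} ⊔-lub z≤n (All.map⁺ (universal bound (allFin n)))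

ccw-surjective : ∀ {m} (w : Fin (suc m)) → ∃ λ v → ccw v ≡ w
ccw-surjective {m} w with m ℕ.≟ toℕ w
... | yes m≡w = zero , toℕ-injective (trans (toℕ-fromℕ m) m≡w)
... | no m≢w  = suc (lower₁ w m≢w) , inject₁-lower₁ w m≢w

module _ {a ℓ} {A : Set a} (_≼_ : Rel A ℓ)
         (≼-refl : Reflexive _≼_) (≼-trans : Transitive _≼_) where

  private
    zero≼ : ∀ {m} (f : Fin (suc m) → A) →
            (∀ (i : Fin m) → f (inject₁ i) ≼ f (suc i)) → ∀ v → f zero ≼ f v
    zero≼ f step zero = ≼-refl
    zero≼ {suc m} f step (suc v) =
      ≼-trans (step zero) (zero≼ (λ x → f (suc x)) (λ i → step (suc i)) v)

    ≼last : ∀ {m} (f : Fin (suc m) → A) →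
            (∀ (i : Fin m) → f (inject₁ i) ≼ f (suc i)) → ∀ v → f v ≼ f (fromℕ m)
    ≼last {zero}  f step zero = ≼-refl
    ≼last {suc m} f step zero =
      ≼-trans (step zero) (≼last (λ x → f (suc x)) (λ i → step (suc i)) zero)
    ≼last {suc m} f step (suc v) = ≼last (λ x → f (suc x)) (λ i → step (suc i)) v

  ccw-increasing⇒related : ∀ {m} (f : Fin (suc m) → A) →
                           (∀ v → f (ccw v) ≼ f v) → ∀ v w → f v ≼ f w
  ccw-increasing⇒related f incr v w =
    ≼-trans (≼last f (λ i → incr (suc i)) v)
            (≼-trans (incr zero) (zero≼ f (λ i → incr (suc i)) w))

ccw-monotone⇒constant : ∀ {m} (f : Fin (suc m) → ℕ) →
                        (∀ v → f (ccw v) ≤ f v) → ∀ v w → f v ≡ f w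
ccw-monotone⇒constant f mono v w = ≤-antisym (related v w) (related w v)
  where
  related : ∀ u u′ → f u ≤ f u′
  related = ccw-increasing⇒related _≤_ ≤-refl ≤-trans f mono

ccw-antitone⇒constant : ∀ {m} (f : Fin (suc m) → ℕ) →
                        (∀ v → f v ≤ f (ccw v)) → ∀ v w → f v ≡ f w
ccw-antitone⇒constant f anti v w = ≤-antisym (related w v) (related v w)
  where
  related : ∀ u u′ → f u′ ≤ f u
  related = ccw-increasing⇒related (λ x y → y ≤ x) ≤-refl (λ p q → ≤-trans q p) f anti

-- σ(v) after v, with counters ρ(v) = r and σ(v) = s, consumes a pulse:
-- this is  snd (fire c v) v.
sent-after : ℕ → ℕ → ℕ → ℕ
sent-after i r s = if not ⌊ suc r ℕ.≟ i ⌋ then suc s else s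

data Local (i r s : ℕ) : Set where
  relaying : r < i → s ≡ suc r → Local i r s
  absorbed : i ≤ r → s ≡ r → Local i r s

Local-step : ∀ {i r s} → Local i r s → Local i (suc r) (sent-after i r s)
Local-step {i} {r} l with suc r ℕ.≟ i | l
... | yes r+1≡i | relaying _ s≡r+1   = absorbed (≤-reflexive (sym r+1≡i)) s≡r+1
... | yes r+1≡i | absorbed i≤r _     = ⊥-elim (<-irrefl (sym r+1≡i) (s≤s i≤r))
... | no r+1≢i  | relaying r<i s≡r+1 = relaying (≤∧≢⇒< r<i r+1≢i)
                                                  (cong suc s≡r+1)
... | no _      | absorbed i≤r s≡r   = absorbed (m≤n⇒m≤1+n i≤r) (cong suc s≡r)

sent-after-increasing : ∀ i r s → s ≤ sent-after i r s
sent-after-increasing i r s with suc r ℕ.≟ i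
... | yes _ = ≤-refl
... | no _  = n≤1+n s

Local-rcv≤snd : ∀ {i r s} → Local i r s → r ≤ s
Local-rcv≤snd (relaying _ refl) = n≤1+n _
Local-rcv≤snd (absorbed _ refl) = ≤-refl

Local-snd≤ID⊔rcv : ∀ {i r s} → Local i r s → s ≤ i ⊔ r
Local-snd≤ID⊔rcv (relaying r<i refl) = m≤n⇒m≤n⊔o _ r<i
Local-snd≤ID⊔rcv (absorbed _ refl)   = m≤n⊔m _ _

Local-balanced⇒ID≤rcv : ∀ {i r} → Local i r r → i ≤ r
Local-balanced⇒ID≤rcv (relaying _ r≡r+1) = ⊥-elim (1+n≢n (sym r≡r+1))
Local-balanced⇒ID≤rcv (absorbed i≤r _)   = i≤r

Local-ID≤rcv⇒balanced : ∀ {i r s} → i ≤ r → Local i r s → s ≡ r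
Local-ID≤rcv⇒balanced i≤r (relaying r<i _) = ⊥-elim (<-irrefl refl (≤-trans r<i i≤r))
Local-ID≤rcv⇒balanced _   (absorbed _ s≡r) = s≡r

module _ {m : ℕ} (ID : Fin (suc m) → ℕ) where
  open Algorithm1 ID

  record Invariant (c : Config (suc m)) : Set where
    field
      local   : ∀ v → Local (ID v) (rcv c v) (snd c v)
      causal  : ∀ v → rcv c v ≤ snd c (ccw v)
      bounded : ∀ v → snd c v ≤ IDmax ID

  fire-snd-increasing : ∀ c v w → snd c w ≤ snd (fire c v) w
  fire-snd-increasing c v w with w ≟ v
  ... | yes refl = sent-after-increasing (ID v) (rcv c v) (snd c v)
  ... | no _     = ≤-refl

  fire-preserves : ∀ {c} v → Invariant c → rcv c v < snd c (ccw v) → Invariant (fire c v)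
  fire-preserves {c} v inv pending =
    record { local = local′ ; causal = causal′ ; bounded = bounded′ }
    where
    open Invariant inv
    local′ : ∀ w → Local (ID w) (rcv (fire c v) w) (snd (fire c v) w)
    local′ w with w ≟ v
    ... | yes refl = Local-step (local v)
    ... | no _     = local w
    causal′ : ∀ w → rcv (fire c v) w ≤ snd (fire c v) (ccw w)
    causal′ w with w ≟ v
    ... | yes refl = ≤-trans pending (fire-snd-increasing c v (ccw v))
    ... | no _     = ≤-trans (causal w) (fire-snd-increasing c v (ccw w))
    bounded′ : ∀ w → snd (fire c v) w ≤ IDmax ID
    bounded′ w with w ≟ v
    ... | yes refl = ≤-trans (Local-snd≤ID⊔rcv (Local-step (local v)))
                             (⊔-lub (IDmax-upperBound ID v) (≤-trans pending (bounded (ccw v))))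
    ... | no _     = bounded w

  invariant : (∀ v → ID v > 0) → ∀ {c} → Reachable c → Invariant c
  invariant ID-positive init = record
    { local   = λ v → relaying (ID-positive v) refl
    ; causal  = λ _ → z≤n
    ; bounded = λ v → ≤-trans (ID-positive v) (IDmax-upperBound ID v) }
  invariant ID-positive (step r v pending) = fire-preserves v (invariant ID-positive r) pending

  quiescent⇒ID≤rcv : ∀ {c} → Invariant c → Quiescent c → ∀ v → ID v ≤ rcv c v
  quiescent⇒ID≤rcv {c} inv quiet w with ccw-surjective w
  ... | v , refl = Local-balanced⇒ID≤rcv (subst (Local _ _) balanced (local (ccw v)))
    where
    open Invariant inv
    rcv-constant : ∀ u u′ → rcv c u ≡ rcv c u′
    rcv-constant = ccw-monotone⇒constant (rcv c)
      (λ u → ≤-trans (Local-rcv≤snd (local (ccw u))) (≤-reflexive (quiet u)))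
    balanced : snd c (ccw v) ≡ rcv c (ccw v)
    balanced = trans (quiet v) (rcv-constant v (ccw v))

  ID≤rcv⇒saturated : ∀ {c} → Invariant c → (∀ v → ID v ≤ rcv c v) →
                     ∀ v → rcv c v ≡ IDmax ID × snd c v ≡ IDmax ID
  ID≤rcv⇒saturated {c} inv ID≤rcv v = rcv≡IDmax v , trans (balanced v) (rcv≡IDmax v)
    where
    open Invariant inv
    balanced : ∀ u → snd c u ≡ rcv c u
    balanced u = Local-ID≤rcv⇒balanced (ID≤rcv u) (local u)
    rcv-constant : ∀ u u′ → rcv c u ≡ rcv c u′
    rcv-constant = ccw-antitone⇒constant (rcv c)
      (λ u → ≤-trans (causal u) (≤-reflexive (balanced (ccw u))))
    rcv≡IDmax : ∀ u → rcv c u ≡ IDmax ID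
    rcv≡IDmax u = ≤-antisym (≤-trans (≤-reflexive (sym (balanced u))) (bounded u))
      (IDmax-least ID (λ u′ → ≤-trans (ID≤rcv u′) (≤-reflexive (rcv-constant u′ u))))

lemma3p6 : ∀ {m : ℕ} (ID : Fin (suc m) → ℕ) →
    Injective _≡_ _≡_ ID → (∀ v → ID v > 0) →
    ∀ (c : Config (suc m)) → Algorithm1.Reachable ID c →
      (Algorithm1.Quiescent ID c → ∀ v → rcv c v ≥ ID v)
      × ((∀ v → rcv c v ≥ ID v) → ∀ v → rcv c v ≡ IDmax ID × snd c v ≡ IDmax ID)
      × ((∀ v → rcv c v ≡ IDmax ID × snd c v ≡ IDmax ID) → Algorithm1.Quiescent ID c)
lemma3p6 ID _ ID-positive c reachable =
  quiescent⇒ID≤rcv ID inv ,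
  ID≤rcv⇒saturated ID inv ,
  λ saturated v → trans (proj₂ (saturated (ccw v))) (sym (proj₁ (saturated v)))
  where
  inv : Invariant ID c
  inv = invariant ID ID-positive reachable
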